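{- Let $T$ be a commutative monad on a category $\mathcal{A}$ with finite products, and assume $\mathrm{Alg}(T)$ is symmetric monoidal $(\otimes,I)$ with $I=T(1)$ such that the free functor is strong monoidal via natural monoidal isomorphisms $\xi\colon T(X)\otimes T(Y)\to T(X\times Y)$. Let $a\colon T(X)\to X$ be a $T$-algebra with a $\overline{T}$-coalgebra $b\colon X\to T(X)$, and let $x\colon I\to X$ be a map in $\mathrm{Alg}(T)$ which lies in the basis, i.e. $b\circ x=\eta_X\circ x$ (equivalently, $x$ factors through the equaliser of $b$ and $\eta_X$). Then $x$ is copyable: $d_b\circ x=(x\otimes x)\circ\rho$, where $\rho\colon I\to I\otimes I$ is the canonical isomorphism and $d_b=(a\otimes a)\circ\xi^{ -1}\circ T(\Delta)\circ b\colon X\to X\otimes X$ with $\Delta\colon X\to X\times X$ the diagonal.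
   Context: $\mathrm{Alg}(T)$ is the category of Eilenberg–Moore algebras of $T=(T,\eta,\mu)$; free algebras are $\mu_X\colon T^2X\to TX$, and an algebra $a$ is an algebra map $\mu_X\to a$. A $\overline{T}$-coalgebra (basis) on $a$ is a map $b\colon X\to TX$ in $\mathcal{A}$ with $b\circ a=\mu_X\circ T(b)$, $a\circ b=\mathrm{id}_X$ and $T(\eta_X)\circ b=T(b)\circ b$. -}

module Defs where

open import Level using (Level; _⊔_) renaming (suc to lsuc)
open import Relation.Binary using (IsEquivalence; Setoid)
import Relation.Binary.Reasoning.Setoid as SetoidR

record Category (o ℓ e : Level) : Set (lsuc (o ⊔ ℓ ⊔ e)) where
  infix  4 _≈_ _⇒_
  infixr 9 _∘_
  field
    Obj       : Set o
    _⇒_       : Obj → Obj → Set ℓ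
    _≈_       : ∀ {A B} → A ⇒ B → A ⇒ B → Set e
    id        : ∀ {A} → A ⇒ A
    _∘_       : ∀ {A B C} → B ⇒ C → A ⇒ B → A ⇒ C
    ≈-equiv   : ∀ {A B} → IsEquivalence (_≈_ {A} {B})
    assoc     : ∀ {A B C D} {f : A ⇒ B} {g : B ⇒ C} {h : C ⇒ D} →
                (h ∘ g) ∘ f ≈ h ∘ (g ∘ f)
    identityˡ : ∀ {A B} {f : A ⇒ B} → id ∘ f ≈ f
    identityʳ : ∀ {A B} {f : A ⇒ B} → f ∘ id ≈ f
    ∘-resp-≈  : ∀ {A B C} {f h : B ⇒ C} {g i : A ⇒ B} →
                f ≈ h → g ≈ i → f ∘ g ≈ h ∘ i

  hom-setoid : Obj → Obj → Setoid ℓ e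
  hom-setoid A B = record { Carrier = A ⇒ B ; _≈_ = _≈_ ; isEquivalence = ≈-equiv }

module _ {o ℓ e} (𝒞 : Category o ℓ e) where
  open Category 𝒞

  record FinProducts : Set (o ⊔ ℓ ⊔ e) where
    infixr 7 _×_
    infixr 8 _⁂_
    field
      𝟙         : Obj
      !         : ∀ {A} → A ⇒ 𝟙
      !-unique  : ∀ {A} (f : A ⇒ 𝟙) → ! ≈ f
      _×_       : Obj → Obj → Obj
      π₁        : ∀ {A B} → A × B ⇒ A
      π₂        : ∀ {A B} → A × B ⇒ B
      ⟨_,_⟩     : ∀ {A B C} → C ⇒ A → C ⇒ B → C ⇒ A × B
      project₁  : ∀ {A B C} {f : C ⇒ A} {g : C ⇒ B} → π₁ ∘ ⟨ f , g ⟩ ≈ f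
      project₂  : ∀ {A B C} {f : C ⇒ A} {g : C ⇒ B} → π₂ ∘ ⟨ f , g ⟩ ≈ g
      ⟨⟩-unique : ∀ {A B C} {f : C ⇒ A} {g : C ⇒ B} {h : C ⇒ A × B} →
                  π₁ ∘ h ≈ f → π₂ ∘ h ≈ g → ⟨ f , g ⟩ ≈ h

    _⁂_ : ∀ {A B C D} → A ⇒ B → C ⇒ D → A × C ⇒ B × D
    f ⁂ g = ⟨ f ∘ π₁ , g ∘ π₂ ⟩

    Δ : ∀ {A} → A ⇒ A × A
    Δ = ⟨ id , id ⟩

    swap : ∀ {A B} → A × B ⇒ B × A
    swap = ⟨ π₂ , π₁ ⟩

    assocʳ : ∀ {A B C} → (A × B) × C ⇒ A × (B × C)
    assocʳ = ⟨ π₁ ∘ π₁ , ⟨ π₂ ∘ π₁ , π₂ ⟩ ⟩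

  record Monad : Set (o ⊔ ℓ ⊔ e) where
    field
      T₀             : Obj → Obj
      T₁             : ∀ {A B} → A ⇒ B → T₀ A ⇒ T₀ B
      T-identity     : ∀ {A} → T₁ (id {A}) ≈ id
      T-homomorphism : ∀ {A B C} {f : A ⇒ B} {g : B ⇒ C} →
                       T₁ (g ∘ f) ≈ T₁ g ∘ T₁ f
      T-resp-≈       : ∀ {A B} {f g : A ⇒ B} → f ≈ g → T₁ f ≈ T₁ g
      η              : ∀ {A} → A ⇒ T₀ A
      μ              : ∀ {A} → T₀ (T₀ A) ⇒ T₀ A
      η-natural      : ∀ {A B} {f : A ⇒ B} → η ∘ f ≈ T₁ f ∘ η
      μ-natural      : ∀ {A B} {f : A ⇒ B} → μ ∘ T₁ (T₁ f) ≈ T₁ f ∘ μ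
      μ-identityˡ    : ∀ {A} → μ {A} ∘ T₁ (η {A}) ≈ id
      μ-identityʳ    : ∀ {A} → μ {A} ∘ η {T₀ A} ≈ id
      μ-assoc        : ∀ {A} → μ {A} ∘ T₁ (μ {A}) ≈ μ {A} ∘ μ {T₀ A}

  record CommutativeStrength (P : FinProducts) (𝕋 : Monad) : Set (o ⊔ ℓ ⊔ e) where
    open FinProducts P
    open Monad 𝕋
    field
      st         : ∀ {A B} → A × T₀ B ⇒ T₀ (A × B)
      st-natural : ∀ {A A′ B B′} {f : A ⇒ A′} {g : B ⇒ B′} →
                   st ∘ (f ⁂ T₁ g) ≈ T₁ (f ⁂ g) ∘ st
      st-unit    : ∀ {B} → T₁ π₂ ∘ st {𝟙} {B} ≈ π₂
      st-assoc   : ∀ {A B C} →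
                   T₁ assocʳ ∘ st {A × B} {C} ≈ st {A} {B × C} ∘ (id ⁂ st {B} {C}) ∘ assocʳ
      st-η       : ∀ {A B} → st {A} {B} ∘ (id ⁂ η) ≈ η
      st-μ       : ∀ {A B} → st {A} {B} ∘ (id ⁂ μ) ≈ μ ∘ T₁ (st {A} {B}) ∘ st {A} {T₀ B}

    cst : ∀ {A B} → T₀ A × B ⇒ T₀ (A × B)
    cst {A} {B} = T₁ swap ∘ st {B} {A} ∘ swap

    field
      commutative : ∀ {A B} →
        μ ∘ T₁ (cst {A} {B}) ∘ st {T₀ A} {B} ≈ μ ∘ T₁ (st {A} {B}) ∘ cst {A} {T₀ B}

  module _ (𝕋 : Monad) where
    open Monad 𝕋

    record Algebra : Set (o ⊔ ℓ ⊔ e) where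
      field
        carrier : Obj
        act     : T₀ carrier ⇒ carrier
        act-η   : act ∘ η ≈ id
        act-μ   : act ∘ T₁ act ≈ act ∘ μ
    open Algebra public

    record AlgHom (A B : Algebra) : Set (ℓ ⊔ e) where
      field
        hom      : carrier A ⇒ carrier B
        commutes : hom ∘ act A ≈ act B ∘ T₁ hom
    open AlgHom public

    private
      module E {A B} = IsEquivalence (≈-equiv {A} {B})

    AlgCat : Category (o ⊔ ℓ ⊔ e) (ℓ ⊔ e) e
    AlgCat = record
      { Obj = Algebra
      ; _⇒_ = AlgHom
      ; _≈_ = λ f g → hom f ≈ hom g
      ; id = λ {A} → record
          { hom = id
          ; commutes = E.trans identityˡ (E.trans (E.sym identityʳ)
                         (∘-resp-≈ E.refl (E.sym T-identity))) }
      ; _∘_ = λ {A} {B} {C} f g → record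
          { hom = hom f ∘ hom g
          ; commutes = comp {A} {B} {C} f g }
      ; ≈-equiv = record { refl = E.refl ; sym = E.sym ; trans = E.trans }
      ; assoc = assoc
      ; identityˡ = identityˡ
      ; identityʳ = identityʳ
      ; ∘-resp-≈ = ∘-resp-≈
      }
      where
      comp : ∀ {A B C} (f : AlgHom B C) (g : AlgHom A B) →
             (hom f ∘ hom g) ∘ act A ≈ act C ∘ T₁ (hom f ∘ hom g)
      comp {A} {B} {C} f g = begin
          (hom f ∘ hom g) ∘ act A      ≈⟨ assoc ⟩
          hom f ∘ (hom g ∘ act A)      ≈⟨ ∘-resp-≈ E.refl (commutes g) ⟩
          hom f ∘ (act B ∘ T₁ (hom g)) ≈⟨ E.sym assoc ⟩
          (hom f ∘ act B) ∘ T₁ (hom g) ≈⟨ ∘-resp-≈ (commutes f) E.refl ⟩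
          (act C ∘ T₁ (hom f)) ∘ T₁ (hom g) ≈⟨ assoc ⟩
          act C ∘ (T₁ (hom f) ∘ T₁ (hom g)) ≈⟨ ∘-resp-≈ E.refl (E.sym T-homomorphism) ⟩
          act C ∘ T₁ (hom f ∘ hom g)   ∎
        where open SetoidR (hom-setoid (T₀ (carrier A)) (carrier C))

    FreeAlg : Obj → Algebra
    FreeAlg X = record
      { carrier = T₀ X ; act = μ ; act-η = μ-identityʳ ; act-μ = μ-assoc }

    FreeHom : ∀ {X Y} → X ⇒ Y → AlgHom (FreeAlg X) (FreeAlg Y)
    FreeHom f = record { hom = T₁ f ; commutes = E.sym μ-natural }

    actHom : (A : Algebra) → AlgHom (FreeAlg (carrier A)) A
    actHom A = record { hom = act A ; commutes = E.sym (act-μ A) }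

    -- a T̄-coalgebra (basis) on an algebra
    record Basis (A : Algebra) : Set (ℓ ⊔ e) where
      field
        b         : carrier A ⇒ T₀ (carrier A)
        b-act     : b ∘ act A ≈ μ ∘ T₁ b
        act-b     : act A ∘ b ≈ id
        b-coassoc : T₁ η ∘ b ≈ T₁ b ∘ b

module _ {o ℓ e} (𝒞 : Category o ℓ e) (I : Category.Obj 𝒞) where
  open Category 𝒞

  record SymMonoidal : Set (o ⊔ ℓ ⊔ e) where
    infixr 10 _⊗₀_ _⊗₁_
    field
      _⊗₀_      : Obj → Obj → Obj
      _⊗₁_      : ∀ {A B C D} → A ⇒ B → C ⇒ D → A ⊗₀ C ⇒ B ⊗₀ D
      ⊗-identity : ∀ {A B} → id {A} ⊗₁ id {B} ≈ id
      ⊗-homomorphism : ∀ {A B C D E F} {f : A ⇒ B} {g : B ⇒ C} {h : D ⇒ E} {k : E ⇒ F} →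
                       (g ∘ f) ⊗₁ (k ∘ h) ≈ (g ⊗₁ k) ∘ (f ⊗₁ h)
      ⊗-resp-≈  : ∀ {A B C D} {f f′ : A ⇒ B} {g g′ : C ⇒ D} →
                  f ≈ f′ → g ≈ g′ → f ⊗₁ g ≈ f′ ⊗₁ g′

      α⇒ : ∀ {A B C} → (A ⊗₀ B) ⊗₀ C ⇒ A ⊗₀ (B ⊗₀ C)
      α⇐ : ∀ {A B C} → A ⊗₀ (B ⊗₀ C) ⇒ (A ⊗₀ B) ⊗₀ C
      α-iso₁ : ∀ {A B C} → α⇒ {A} {B} {C} ∘ α⇐ ≈ id
      α-iso₂ : ∀ {A B C} → α⇐ {A} {B} {C} ∘ α⇒ ≈ id
      α-natural : ∀ {A A′ B B′ C C′} {f : A ⇒ A′} {g : B ⇒ B′} {h : C ⇒ C′} →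
                  α⇒ ∘ ((f ⊗₁ g) ⊗₁ h) ≈ (f ⊗₁ (g ⊗₁ h)) ∘ α⇒

      λ⇒ : ∀ {A} → I ⊗₀ A ⇒ A
      λ⇐ : ∀ {A} → A ⇒ I ⊗₀ A
      λ-iso₁ : ∀ {A} → λ⇒ {A} ∘ λ⇐ ≈ id
      λ-iso₂ : ∀ {A} → λ⇐ {A} ∘ λ⇒ ≈ id
      λ-natural : ∀ {A B} {f : A ⇒ B} → λ⇒ ∘ (id ⊗₁ f) ≈ f ∘ λ⇒

      ρ⇒ : ∀ {A} → A ⊗₀ I ⇒ A
      ρ⇐ : ∀ {A} → A ⇒ A ⊗₀ I
      ρ-iso₁ : ∀ {A} → ρ⇒ {A} ∘ ρ⇐ ≈ id
      ρ-iso₂ : ∀ {A} → ρ⇐ {A} ∘ ρ⇒ ≈ id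
      ρ-natural : ∀ {A B} {f : A ⇒ B} → ρ⇒ ∘ (f ⊗₁ id) ≈ f ∘ ρ⇒

      σ : ∀ {A B} → A ⊗₀ B ⇒ B ⊗₀ A
      σ-natural : ∀ {A A′ B B′} {f : A ⇒ A′} {g : B ⇒ B′} →
                  σ ∘ (f ⊗₁ g) ≈ (g ⊗₁ f) ∘ σ
      σ-involutive : ∀ {A B} → σ {B} {A} ∘ σ {A} {B} ≈ id

      triangle : ∀ {A B} → (id {A} ⊗₁ λ⇒ {B}) ∘ α⇒ ≈ ρ⇒ ⊗₁ id
      pentagon : ∀ {A B C D} →
                 (id {A} ⊗₁ α⇒ {B} {C} {D}) ∘ α⇒ ∘ (α⇒ ⊗₁ id) ≈ α⇒ ∘ α⇒
      hexagon  : ∀ {A B C} →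
                 α⇒ {B} {C} {A} ∘ σ ∘ α⇒ ≈ (id ⊗₁ σ) ∘ α⇒ ∘ (σ ⊗₁ id)

-- Setting of the paper: Alg(T) symmetric monoidal with unit I = T(1),
-- free functor strong monoidal via ξ (unit comparison = identity).

module _ {o ℓ e} (𝒜 : Category o ℓ e) (P : FinProducts 𝒜) (𝕋 : Monad 𝒜) where
  open Category 𝒜
  open FinProducts P
  open Monad 𝕋

  AlgMonoidal : Set (o ⊔ ℓ ⊔ e)
  AlgMonoidal = SymMonoidal (AlgCat 𝒜 𝕋) (FreeAlg 𝒜 𝕋 𝟙)

  record StrongMonoidalFree (M : AlgMonoidal) : Set (o ⊔ ℓ ⊔ e) where
    open SymMonoidal M
    private
      F₀ = FreeAlg 𝒜 𝕋
      F₁ : ∀ {X Y} → X ⇒ Y → AlgHom 𝒜 𝕋 (F₀ X) (F₀ Y)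
      F₁ = FreeHom 𝒜 𝕋
      idA : ∀ {A} → AlgHom 𝒜 𝕋 A A
      idA = Category.id (AlgCat 𝒜 𝕋)
    field
      ξ   : ∀ {X Y} → AlgHom 𝒜 𝕋 (F₀ X ⊗₀ F₀ Y) (F₀ (X × Y))
      ξ⁻¹ : ∀ {X Y} → AlgHom 𝒜 𝕋 (F₀ (X × Y)) (F₀ X ⊗₀ F₀ Y)
      ξ-iso₁ : ∀ {X Y} → hom (ξ {X} {Y}) ∘ hom ξ⁻¹ ≈ id
      ξ-iso₂ : ∀ {X Y} → hom (ξ⁻¹ {X} {Y}) ∘ hom ξ ≈ id
      ξ-natural : ∀ {X X′ Y Y′} (f : X ⇒ X′) (g : Y ⇒ Y′) →
                  hom ξ ∘ hom (F₁ f ⊗₁ F₁ g) ≈ T₁ (f ⁂ g) ∘ hom ξ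
      ξ-assoc : ∀ {X Y Z} →
                T₁ (assocʳ {X} {Y} {Z}) ∘ hom ξ ∘ hom (ξ ⊗₁ idA)
                  ≈ hom ξ ∘ hom (idA ⊗₁ ξ) ∘ hom α⇒
      ξ-unitˡ : ∀ {X} → T₁ π₂ ∘ hom (ξ {𝟙} {X}) ≈ hom λ⇒
      ξ-unitʳ : ∀ {X} → T₁ π₁ ∘ hom (ξ {X} {𝟙}) ≈ hom ρ⇒

  module _ {M : AlgMonoidal} (S : StrongMonoidalFree M) where
    open SymMonoidal M
    open StrongMonoidalFree S

    InBasis : {A : Algebra 𝒜 𝕋} → Basis 𝒜 𝕋 A →
              AlgHom 𝒜 𝕋 (FreeAlg 𝒜 𝕋 𝟙) A → Set e
    InBasis B x = Basis.b B ∘ hom x ≈ η ∘ hom x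

    copyMap : {A : Algebra 𝒜 𝕋} → Basis 𝒜 𝕋 A → carrier A ⇒ carrier (A ⊗₀ A)
    copyMap {A} B =
      hom (actHom 𝒜 𝕋 A ⊗₁ actHom 𝒜 𝕋 A) ∘ hom ξ⁻¹ ∘ T₁ Δ ∘ Basis.b B

    Copyable : {A : Algebra 𝒜 𝕋} → Basis 𝒜 𝕋 A →
               AlgHom 𝒜 𝕋 (FreeAlg 𝒜 𝕋 𝟙) A → Set e
    Copyable B x = copyMap B ∘ hom x ≈ hom (x ⊗₁ x) ∘ hom ρ⇐

module Submission where

-- A map of algebras x : T(1) → X out of a free algebra is
-- determined by its point x₀ = x ∘ η : 1 → X, namely x = a ∘ T(x₀).  If x
-- lies in the basis, the coalgebra laws give b ∘ x = T(x₀), so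
--   d_b ∘ x = (a ⊗ a) ∘ ξ⁻¹ ∘ T(Δ ∘ x₀) = (a ⊗ a) ∘ ξ⁻¹ ∘ T(x₀ × x₀) ∘ T(Δ).
-- Naturality of ξ⁻¹ moves T(x₀ × x₀) past ξ⁻¹ as T(x₀) ⊗ T(x₀), which the
-- factors a ⊗ a turn back into x ⊗ x; finally ξ⁻¹ ∘ T(Δ) on T(1) is the unitor
-- ρ⁻¹ : I → I ⊗ I, because ρ = T(π₁) ∘ ξ and π₁ ∘ Δ = id.

open import Defs
open import Relation.Binary using (IsEquivalence)
import Relation.Binary.Reasoning.Setoid as SetoidR

module CategoryLemmas {o ℓ e} (𝒞 : Category o ℓ e) where
  open Category 𝒞
  open module E {A B} = IsEquivalence (≈-equiv {A} {B}) public
    using () renaming (refl to ≈-refl; sym to ≈-sym; trans to ≈-trans)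
  open module R {A B} = SetoidR (hom-setoid A B) public

  infixr 4 refl⟩∘⟨_ _⟩∘⟨refl

  refl⟩∘⟨_ : ∀ {A B C} {f : B ⇒ C} {g h : A ⇒ B} → g ≈ h → f ∘ g ≈ f ∘ h
  refl⟩∘⟨ p = ∘-resp-≈ ≈-refl p

  _⟩∘⟨refl : ∀ {A B C} {f g : B ⇒ C} {h : A ⇒ B} → f ≈ g → f ∘ h ≈ g ∘ h
  p ⟩∘⟨refl = ∘-resp-≈ p ≈-refl

  pullˡ : ∀ {A B C D} {f : C ⇒ D} {g : B ⇒ C} {h : B ⇒ D} {k : A ⇒ B} →
          f ∘ g ≈ h → f ∘ (g ∘ k) ≈ h ∘ k
  pullˡ p = ≈-trans (≈-sym assoc) (p ⟩∘⟨refl)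

  pullʳ : ∀ {A B C D} {f : C ⇒ D} {g : B ⇒ C} {k : A ⇒ B} {h : A ⇒ C} →
          g ∘ k ≈ h → (f ∘ g) ∘ k ≈ f ∘ h
  pullʳ p = ≈-trans assoc (refl⟩∘⟨ p)

  cancelˡ : ∀ {A B C} {f : B ⇒ C} {g : C ⇒ B} {h : A ⇒ C} →
            f ∘ g ≈ id → f ∘ (g ∘ h) ≈ h
  cancelˡ p = ≈-trans (pullˡ p) identityˡ

  right-inverse-unique : ∀ {A B} {s : A ⇒ B} {r k : B ⇒ A} →
                         r ∘ s ≈ id → s ∘ k ≈ id → k ≈ r
  right-inverse-unique {s = s} {r} {k} rs sk = begin
    k             ≈⟨ ≈-sym (cancelˡ rs) ⟩
    r ∘ (s ∘ k)   ≈⟨ refl⟩∘⟨ sk ⟩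
    r ∘ id        ≈⟨ identityʳ ⟩
    r             ∎

  square-inverse : ∀ {P Q P′ Q′} {k : P ⇒ Q} {k⁻¹ : Q ⇒ P}
                   {k′ : P′ ⇒ Q′} {k′⁻¹ : Q′ ⇒ P′} {u : P ⇒ P′} {v : Q ⇒ Q′} →
                   k ∘ k⁻¹ ≈ id → k′⁻¹ ∘ k′ ≈ id → k′ ∘ u ≈ v ∘ k →
                   k′⁻¹ ∘ v ≈ u ∘ k⁻¹
  square-inverse {k = k} {k⁻¹} {k′} {k′⁻¹} {u} {v} kk⁻¹ k′⁻¹k′ sq = begin
    k′⁻¹ ∘ v                  ≈⟨ refl⟩∘⟨ ≈-sym (≈-trans (refl⟩∘⟨ kk⁻¹) identityʳ) ⟩
    k′⁻¹ ∘ (v ∘ (k ∘ k⁻¹))    ≈⟨ refl⟩∘⟨ pullˡ (≈-sym sq) ⟩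
    k′⁻¹ ∘ ((k′ ∘ u) ∘ k⁻¹)   ≈⟨ refl⟩∘⟨ assoc ⟩
    k′⁻¹ ∘ (k′ ∘ (u ∘ k⁻¹))   ≈⟨ cancelˡ k′⁻¹k′ ⟩
    u ∘ k⁻¹                   ∎

module ProductLemmas {o ℓ e} {𝒞 : Category o ℓ e} (P : FinProducts 𝒞) where
  open Category 𝒞
  open FinProducts P
  open CategoryLemmas 𝒞

  ⟨⟩-cong : ∀ {A B C} {f f′ : C ⇒ A} {g g′ : C ⇒ B} →
            f ≈ f′ → g ≈ g′ → ⟨ f , g ⟩ ≈ ⟨ f′ , g′ ⟩
  ⟨⟩-cong p q = ⟨⟩-unique (≈-trans project₁ (≈-sym p)) (≈-trans project₂ (≈-sym q))

  ⟨⟩-∘ : ∀ {A B C D} {f : C ⇒ A} {g : C ⇒ B} {h : D ⇒ C} →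
         ⟨ f ∘ h , g ∘ h ⟩ ≈ ⟨ f , g ⟩ ∘ h
  ⟨⟩-∘ = ⟨⟩-unique (pullˡ project₁) (pullˡ project₂)

  ⁂-∘-⟨⟩ : ∀ {A A′ B B′ C} {f : A ⇒ A′} {g : B ⇒ B′} {h : C ⇒ A} {k : C ⇒ B} →
           ⟨ f ∘ h , g ∘ k ⟩ ≈ (f ⁂ g) ∘ ⟨ h , k ⟩
  ⁂-∘-⟨⟩ {A} {A′} {B} {B′} {C} {f} {g} {h} {k} = ⟨⟩-unique (side project₁ project₁) (side project₂ project₂)
    where
    side : ∀ {X Z} {π : A′ × B′ ⇒ X} {p : Z ⇒ X} {π′ : A × B ⇒ Z} {q : C ⇒ Z} →
           π ∘ (f ⁂ g) ≈ p ∘ π′ → π′ ∘ ⟨ h , k ⟩ ≈ q →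
           π ∘ ((f ⁂ g) ∘ ⟨ h , k ⟩) ≈ p ∘ q
    side outer inner = ≈-trans (pullˡ outer) (pullʳ inner)

  Δ-natural : ∀ {A B} {f : A ⇒ B} → Δ ∘ f ≈ (f ⁂ f) ∘ Δ
  Δ-natural {f = f} = begin
    Δ ∘ f                   ≈⟨ ≈-sym ⟨⟩-∘ ⟩
    ⟨ id ∘ f , id ∘ f ⟩     ≈⟨ ⟨⟩-cong same same ⟩
    ⟨ f ∘ id , f ∘ id ⟩     ≈⟨ ⁂-∘-⟨⟩ ⟩
    (f ⁂ f) ∘ Δ             ∎
    where
    same : id ∘ f ≈ f ∘ id
    same = ≈-trans identityˡ (≈-sym identityʳ)

module MonadLemmas {o ℓ e} {𝒜 : Category o ℓ e} (𝕋 : Monad 𝒜) where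
  open Category 𝒜
  open Monad 𝕋
  open CategoryLemmas 𝒜

  T-square : ∀ {A B C D} {f : A ⇒ B} {g : B ⇒ D} {h : A ⇒ C} {k : C ⇒ D} →
             g ∘ f ≈ k ∘ h → T₁ g ∘ T₁ f ≈ T₁ k ∘ T₁ h
  T-square sq = ≈-trans (≈-sym T-homomorphism) (≈-trans (T-resp-≈ sq) T-homomorphism)

  free-hom-from-point : ∀ {X} {A : Algebra 𝒜 𝕋} (h : AlgHom 𝒜 𝕋 (FreeAlg 𝒜 𝕋 X) A) →
                        hom h ≈ act A ∘ T₁ (hom h ∘ η)
  free-hom-from-point {A = A} h = begin
    hom h                     ≈⟨ ≈-sym identityʳ ⟩
    hom h ∘ id                ≈⟨ refl⟩∘⟨ ≈-sym μ-identityˡ ⟩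
    hom h ∘ (μ ∘ T₁ η)        ≈⟨ pullˡ (commutes h) ⟩
    (act A ∘ T₁ (hom h)) ∘ T₁ η ≈⟨ pullʳ (≈-sym T-homomorphism) ⟩
    act A ∘ T₁ (hom h ∘ η)    ∎

  module _ {A : Algebra 𝒜 𝕋} (B : Basis 𝒜 𝕋 A) where
    open Basis B

    basis-point : ∀ {Y} {p : Y ⇒ carrier A} → b ∘ p ≈ η ∘ p → b ∘ (act A ∘ T₁ p) ≈ T₁ p
    basis-point {p = p} inB = begin
      b ∘ (act A ∘ T₁ p)   ≈⟨ pullˡ b-act ⟩
      (μ ∘ T₁ b) ∘ T₁ p    ≈⟨ pullʳ (T-square inB) ⟩
      μ ∘ (T₁ η ∘ T₁ p)    ≈⟨ cancelˡ μ-identityˡ ⟩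
      T₁ p                 ∎

    basis-free-hom : ∀ {Y} (x : AlgHom 𝒜 𝕋 (FreeAlg 𝒜 𝕋 Y) A) →
                     b ∘ hom x ≈ η ∘ hom x → b ∘ hom x ≈ T₁ (hom x ∘ η)
    basis-free-hom x inB = begin
      b ∘ hom x                       ≈⟨ refl⟩∘⟨ free-hom-from-point x ⟩
      b ∘ (act A ∘ T₁ (hom x ∘ η))    ≈⟨ basis-point point-in-basis ⟩
      T₁ (hom x ∘ η)                  ∎
      where
      point-in-basis : b ∘ (hom x ∘ η) ≈ η ∘ (hom x ∘ η)
      point-in-basis = ≈-trans (pullˡ inB) assoc

module StrongMonoidalLemmas {o ℓ e} {𝒜 : Category o ℓ e} {P : FinProducts 𝒜}
  {𝕋 : Monad 𝒜} {M : AlgMonoidal 𝒜 P 𝕋} (S : StrongMonoidalFree 𝒜 P 𝕋 M) where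
  open Category 𝒜
  open FinProducts P
  open Monad 𝕋
  open SymMonoidal M
  open StrongMonoidalFree S
  open CategoryLemmas 𝒜
  open MonadLemmas 𝕋

  ξ⁻¹-natural : ∀ {X X′ Y Y′} (f : X ⇒ X′) (g : Y ⇒ Y′) →
                hom ξ⁻¹ ∘ T₁ (f ⁂ g) ≈ hom (FreeHom 𝒜 𝕋 f ⊗₁ FreeHom 𝒜 𝕋 g) ∘ hom ξ⁻¹
  ξ⁻¹-natural f g = square-inverse ξ-iso₁ ξ-iso₂ (ξ-natural f g)

  -- On T(1), ξ⁻¹ ∘ T(Δ) is the unitor ρ⁻¹ : I → I ⊗ I, since ρ = T(π₁) ∘ ξ.
  ξ⁻¹-diagonal : hom (ξ⁻¹ {𝟙} {𝟙}) ∘ T₁ Δ ≈ hom ρ⇐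
  ξ⁻¹-diagonal = right-inverse-unique ρ-iso₂ (begin
    hom ρ⇒ ∘ (hom ξ⁻¹ ∘ T₁ Δ)          ≈⟨ ≈-sym ξ-unitʳ ⟩∘⟨refl ⟩
    (T₁ π₁ ∘ hom ξ) ∘ (hom ξ⁻¹ ∘ T₁ Δ)  ≈⟨ pullʳ (cancelˡ ξ-iso₁) ⟩
    T₁ π₁ ∘ T₁ Δ                       ≈⟨ ≈-sym T-homomorphism ⟩
    T₁ (π₁ ∘ Δ)                        ≈⟨ T-resp-≈ project₁ ⟩
    T₁ id                              ≈⟨ T-identity ⟩
    id                                 ∎)

  act-⊗-free-points : ∀ {X Y} {A A′ : Algebra 𝒜 𝕋}
    (x : AlgHom 𝒜 𝕋 (FreeAlg 𝒜 𝕋 X) A) (y : AlgHom 𝒜 𝕋 (FreeAlg 𝒜 𝕋 Y) A′) →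
    hom (actHom 𝒜 𝕋 A ⊗₁ actHom 𝒜 𝕋 A′)
      ∘ hom (FreeHom 𝒜 𝕋 (hom x ∘ η) ⊗₁ FreeHom 𝒜 𝕋 (hom y ∘ η))
      ≈ hom (x ⊗₁ y)
  act-⊗-free-points x y =
    ≈-trans (≈-sym ⊗-homomorphism)
            (⊗-resp-≈ (≈-sym (free-hom-from-point x)) (≈-sym (free-hom-from-point y)))

-- Proposition 6.5: an algebra point x : I → X lying in the basis is copyable.
proposition6p5 : ∀ {o ℓ e} (𝒜 : Category o ℓ e) (P : FinProducts 𝒜) (𝕋 : Monad 𝒜)
    (C : CommutativeStrength 𝒜 P 𝕋)
    (M : AlgMonoidal 𝒜 P 𝕋) (S : StrongMonoidalFree 𝒜 P 𝕋 M)
    (A : Algebra 𝒜 𝕋) (B : Basis 𝒜 𝕋 A)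
    (x : AlgHom 𝒜 𝕋 (FreeAlg 𝒜 𝕋 (FinProducts.𝟙 P)) A) →
    InBasis 𝒜 P 𝕋 S B x → Copyable 𝒜 P 𝕋 S B x
proposition6p5 𝒜 P 𝕋 _ M S A B x inB = begin
  (aa ∘ hom ξ⁻¹ ∘ T₁ Δ ∘ b) ∘ hom x      ≈⟨ ≈-trans assoc (refl⟩∘⟨ ≈-trans assoc (refl⟩∘⟨ assoc)) ⟩
  aa ∘ hom ξ⁻¹ ∘ T₁ Δ ∘ b ∘ hom x        ≈⟨ refl⟩∘⟨ refl⟩∘⟨ refl⟩∘⟨ basis-free-hom B x inB ⟩
  aa ∘ hom ξ⁻¹ ∘ T₁ Δ ∘ T₁ x₀            ≈⟨ refl⟩∘⟨ refl⟩∘⟨ T-square Δ-natural ⟩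
  aa ∘ hom ξ⁻¹ ∘ T₁ (x₀ ⁂ x₀) ∘ T₁ Δ     ≈⟨ refl⟩∘⟨ pullˡ (ξ⁻¹-natural x₀ x₀) ⟩
  aa ∘ (hom Fx ∘ hom ξ⁻¹) ∘ T₁ Δ         ≈⟨ refl⟩∘⟨ pullʳ ξ⁻¹-diagonal ⟩
  aa ∘ hom Fx ∘ hom ρ⇐                   ≈⟨ pullˡ (act-⊗-free-points x x) ⟩
  hom (x ⊗₁ x) ∘ hom ρ⇐                  ∎
  where
  open Category 𝒜
  open FinProducts P
  open Monad 𝕋
  open SymMonoidal M
  open StrongMonoidalFree S
  open Basis B
  open CategoryLemmas 𝒜
  open ProductLemmas P
  open MonadLemmas 𝕋
  open StrongMonoidalLemmas S

  x₀ : 𝟙 ⇒ carrier A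
  x₀ = hom x ∘ η

  F₀ : Obj → Algebra 𝒜 𝕋
  F₀ = FreeAlg 𝒜 𝕋

  aa : carrier (F₀ (carrier A) ⊗₀ F₀ (carrier A)) ⇒ carrier (A ⊗₀ A)
  aa = hom (actHom 𝒜 𝕋 A ⊗₁ actHom 𝒜 𝕋 A)

  Fx : AlgHom 𝒜 𝕋 (F₀ 𝟙 ⊗₀ F₀ 𝟙) (F₀ (carrier A) ⊗₀ F₀ (carrier A))
  Fx = FreeHom 𝒜 𝕋 x₀ ⊗₁ FreeHom 𝒜 𝕋 x₀
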